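{- Let $r,k\geq 3$ be integers. If $(v,b,r,k)$ and $(v',b',r,k)$ are configurable tuples, then $(v+v',b+b',r,k)$ is a configurable tuple.
   Context: For positive integers $v,b,r,k$, a $(v,b,r,k)$-configuration is a connected bipartite graph with $v$ vertices on one side, each of degree $r$, and $b$ vertices on the other side, each of degree $k$, containing no cycle of length $4$. A tuple $(v,b,r,k)$ is configurable if such a configuration exists; by convention the empty graph is also regarded as a configuration, so the tuple with $v=b=0$ is configurable. -}

module Defs where

open import Data.Nat using (ℕ; zero; suc; _+_)
open import Data.Fin using (Fin; zero; suc)
open import Data.Bool using (Bool; true; false; if_then_else_)
open import Data.Sum using (_⊎_; inj₁; inj₂)
open import Data.Product using (Σ; _×_)
open import Relation.Binary.PropositionalEquality using (_≡_)
open import Relation.Nullary using (¬_)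
open import Relation.Binary.Construct.Closure.ReflexiveTransitive using (Star)

count : ∀ {n} → (Fin n → Bool) → ℕ
count {zero}  f = 0
count {suc n} f = (if f zero then 1 else 0) + count (λ i → f (suc i))

-- A bipartite graph with v "point" vertices and b "line" vertices,
-- given by its (simple) incidence relation.
Incidence : ℕ → ℕ → Set
Incidence v b = Fin v → Fin b → Bool

Vertex : ℕ → ℕ → Set
Vertex v b = Fin v ⊎ Fin b

Adj : ∀ {v b} → Incidence v b → Vertex v b → Vertex v b → Set
Adj I (inj₁ p) (inj₁ p') = Data.Empty.⊥ where import Data.Empty
Adj I (inj₁ p) (inj₂ l)  = I p l ≡ true
Adj I (inj₂ l) (inj₁ p)  = I p l ≡ true
Adj I (inj₂ l) (inj₂ l') = Data.Empty.⊥ where import Data.Empty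

Connected : ∀ {v b} → Incidence v b → Set
Connected I = ∀ x y → Star (Adj I) x y

PointRegular : ∀ {v b} → Incidence v b → ℕ → Set
PointRegular I r = ∀ p → count (λ l → I p l) ≡ r

LineRegular : ∀ {v b} → Incidence v b → ℕ → Set
LineRegular I k = ∀ l → count (λ p → I p l) ≡ k

NoFourCycle : ∀ {v b} → Incidence v b → Set
NoFourCycle {v} {b} I =
  (p p' : Fin v) (l l' : Fin b) → ¬ p ≡ p' → ¬ l ≡ l' →
  ¬ (I p l ≡ true × I p l' ≡ true × I p' l ≡ true × I p' l' ≡ true)

record Configuration (v b r k : ℕ) : Set where
  field
    incidence    : Incidence v b
    connected    : Connected incidence
    pointDegree  : PointRegular incidence r
    lineDegree   : LineRegular incidence k
    noFourCycle  : NoFourCycle incidence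

-- (v,b,r,k) is configurable if a configuration exists. With v = b = 0 the
-- empty graph is a configuration (all conditions vacuous), matching the
-- paper's convention.
Configurable : ℕ → ℕ → ℕ → ℕ → Set
Configurable v b r k = Configuration v b r k

-- Minimum degree at least 2 forces a cycle in the first configuration (a path that never
-- backtracks must revisit a vertex), so it has an edge pl lying on a cycle. Take any edge
-- p'l' of the second configuration and, in the disjoint union, replace pl and p'l' by the
-- cross edges pl' and p'l. Every degree is unchanged. A 4-cycle through a cross edge would
-- have to use both cross edges and hence the deleted edge pl. The result is connected: pl
-- is replaced by the rest of its cycle, and p'l' by the walk p' — l ⋯ p — l'.

module Submission where

open import Defs
open import Data.Nat using (ℕ; zero; suc; _+_; _≤_; _<_; z≤n; s≤s)
open import Data.Nat.Properties
  using (+-commutativeSemigroup; +-comm; +-identityʳ; +-suc; ≤-trans; n≤1+n; m<m+n; <⇒≱)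
open import Data.Fin using (Fin; zero; suc; splitAt; join; _↑ˡ_; _↑ʳ_; _≟_)
open import Data.Fin.Properties
  using (splitAt-↑ˡ; splitAt-↑ʳ; splitAt⁻¹-↑ˡ; splitAt⁻¹-↑ʳ; join-splitAt)
open import Data.Bool using (Bool; true; false; not; _∧_; if_then_else_)
open import Data.Bool.Properties using (∧-comm; ∧-inverseˡ)
open import Data.Sum using (_⊎_; inj₁; inj₂)
import Data.Sum as Sum
open import Data.Sum.Properties using (≡-dec; inj₁-injective; inj₂-injective)
open import Data.Product using (∃-syntax; ∃₂; _×_; _,_; proj₁; proj₂; map₂)
open import Data.Empty using (⊥; ⊥-elim)
open import Data.List using (List; []; _∷_; length; _++_; map; allFin)
open import Data.List.Relation.Unary.Any using (here; there; any?)
open import Data.List.Relation.Unary.All using (All; []; _∷_; lookup)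
open import Data.List.Relation.Unary.All.Properties using (¬Any⇒All¬)
open import Data.List.Relation.Unary.AllPairs using ([]; _∷_)
open import Data.List.Relation.Unary.Linked using (Linked; [-]; _∷_)
open import Data.List.Relation.Unary.Unique.Propositional using (Unique)
open import Data.List.Membership.Propositional using (_∈_)
open import Data.List.Membership.Propositional.Properties
  using (∈-++⁺ˡ; ∈-++⁺ʳ; ∈-map⁺; ∈-allFin)
open import Data.List.Relation.Binary.Subset.Propositional using (_⊆_)
open import Function using (flip; _∘_)
open import Level using (0ℓ)
open import Relation.Binary.Core using (Rel)
open import Relation.Binary.Definitions using (Symmetric; DecidableEquality)
open import Relation.Binary.PropositionalEquality
open import Relation.Binary.Construct.Closure.ReflexiveTransitive
  using (Star; ε; _◅_; _◅◅_; reverse; gmap; kleisliStar)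
open import Relation.Nullary using (¬_; yes; no; does; contradiction)
open import Relation.Nullary.Decidable using (dec-true; _×-dec_)
open import Algebra.Properties.CommutativeSemigroup +-commutativeSemigroup
  using () renaming (x∙yz≈y∙xz to +-leftComm)

open ≡-Reasoning

count-cong : ∀ {n} {f g : Fin n → Bool} → (∀ i → f i ≡ g i) → count f ≡ count g
count-cong {zero}  f≗g = refl
count-cong {suc n} f≗g =
  cong₂ _+_ (cong (λ β → if β then 1 else 0) (f≗g zero)) (count-cong (f≗g ∘ suc))

count-false : ∀ n → count {n} (λ _ → false) ≡ 0
count-false zero    = refl
count-false (suc n) = count-false n

does-suc≟suc : ∀ {n} (i j : Fin n) → does (suc i ≟ suc j) ≡ does (i ≟ j)
does-suc≟suc i j with i ≟ j
... | yes _ = refl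
... | no _  = refl

count-isolate : ∀ {n} (f : Fin n → Bool) (j : Fin n) →
  count f ≡ (if f j then 1 else 0) + count (λ i → not (does (i ≟ j)) ∧ f i)
count-isolate f zero = refl
count-isolate f (suc j) = begin
  c₀ + count (f ∘ suc)
    ≡⟨ cong (c₀ +_) (count-isolate (f ∘ suc) j) ⟩
  c₀ + (cⱼ + count (λ i → not (does (i ≟ j)) ∧ f (suc i)))
    ≡⟨ +-leftComm c₀ cⱼ _ ⟩
  cⱼ + (c₀ + count (λ i → not (does (i ≟ j)) ∧ f (suc i)))
    ≡⟨ cong (λ x → cⱼ + (c₀ + x)) (count-cong shift) ⟩
  cⱼ + (c₀ + count (λ i → not (does (suc i ≟ suc j)) ∧ f (suc i))) ∎
  where
  c₀ = if f zero then 1 else 0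
  cⱼ = if f (suc j) then 1 else 0
  shift : ∀ i → (not (does (i ≟ j)) ∧ f (suc i)) ≡ (not (does (suc i ≟ suc j)) ∧ f (suc i))
  shift i = cong (λ β → not β ∧ f (suc i)) (sym (does-suc≟suc i j))

count-≟ : ∀ {n} (j : Fin n) → count (λ i → does (i ≟ j)) ≡ 1
count-≟ {n} j = begin
  count (λ i → does (i ≟ j))
    ≡⟨ count-isolate _ j ⟩
  (if does (j ≟ j) then 1 else 0) + count (λ i → not (does (i ≟ j)) ∧ does (i ≟ j))
    ≡⟨ cong₂ _+_ (cong (λ β → if β then 1 else 0) (dec-true (j ≟ j) refl))
                 (trans (count-cong (λ i → ∧-inverseˡ (does (i ≟ j)))) (count-false n)) ⟩
  1 ∎

count-splitAt : ∀ m {n} (h : Fin m ⊎ Fin n → Bool) →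
  count (h ∘ splitAt m) ≡ count (h ∘ inj₁) + count (h ∘ inj₂)
count-splitAt zero    h = refl
count-splitAt (suc m) h with h (inj₁ zero)
... | true  = cong suc (count-splitAt m (h ∘ Sum.map₁ suc))
... | false = count-splitAt m (h ∘ Sum.map₁ suc)

count-witness : ∀ {n} (f : Fin n → Bool) → 1 ≤ count f → ∃[ i ] f i ≡ true
count-witness {suc n} f 1≤count with f zero in e
... | true  = zero , e
... | false with i , e' ← count-witness (f ∘ suc) 1≤count = suc i , e'

count-witness-≢ : ∀ {n} (f : Fin n → Bool) → 2 ≤ count f → (j : Fin n) →
  ∃[ i ] i ≢ j × f i ≡ true
count-witness-≢ f 2≤count j =
  map₂ (unmark _) (count-witness _ (drop-indicator (f j) (subst (2 ≤_) (count-isolate f j) 2≤count)))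
  where
  drop-indicator : ∀ β {c} → 2 ≤ (if β then 1 else 0) + c → 1 ≤ c
  drop-indicator true  (s≤s 1≤c) = 1≤c
  drop-indicator false 2≤c       = ≤-trans (n≤1+n 1) 2≤c
  unmark : ∀ i → not (does (i ≟ j)) ∧ f i ≡ true → i ≢ j × f i ≡ true
  unmark i e with i ≟ j
  ... | no i≢j = i≢j , e

∈-remove : ∀ {A : Set} {x : A} ys → x ∈ ys →
  ∃[ ys' ] length ys ≡ suc (length ys') × (∀ {z} → z ∈ ys → z ≢ x → z ∈ ys')
∈-remove (y ∷ ys) (here refl) =
  ys , refl , λ { (here refl) z≢y → ⊥-elim (z≢y refl) ; (there z∈ys) _ → z∈ys }
∈-remove (y ∷ ys) (there x∈ys) with ys' , eq , keep ← ∈-remove ys x∈ys =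
  y ∷ ys' , cong suc eq ,
  λ { (here refl) _ → here refl ; (there z∈ys) z≢x → there (keep z∈ys z≢x) }

Unique-⊆⇒length≤ : ∀ {A : Set} {xs ys : List A} → Unique xs → xs ⊆ ys →
  length xs ≤ length ys
Unique-⊆⇒length≤ {xs = []}     _              _     = z≤n
Unique-⊆⇒length≤ {xs = x ∷ xs} (x∉xs ∷ uniq) xs⊆ys
  with ys' , len≡ , keep ← ∈-remove _ (xs⊆ys (here refl)) =
  subst (suc (length xs) ≤_) (sym len≡)
    (s≤s (Unique-⊆⇒length≤ uniq λ z∈xs →
      keep (xs⊆ys (there z∈xs)) λ z≡x → lookup x∉xs z∈xs (sym z≡x)))

Avoiding : ∀ {V : Set} → Rel V 0ℓ → V → V → Rel V 0ℓ
Avoiding E u w x y = E x y × ¬ (x ≡ u × y ≡ w) × ¬ (x ≡ w × y ≡ u)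

avoiding-reverse : ∀ {V : Set} {E : Rel V 0ℓ} → Symmetric E →
  ∀ {u w x y} → Avoiding E u w x y → Avoiding E w u y x
avoiding-reverse E-sym (e , ¬uw , ¬wu) =
  E-sym e , (λ (y≡w , x≡u) → ¬uw (x≡u , y≡w)) , (λ (y≡u , x≡w) → ¬wu (x≡w , y≡u))

reroute : ∀ {V W : Set} {E : Rel V 0ℓ} {F : Rel W 0ℓ} → DecidableEquality V →
  (f : V → W) → Symmetric F → ∀ {u w} → Star F (f u) (f w) →
  (∀ {x y} → Avoiding E u w x y → F (f x) (f y)) →
  ∀ {x y} → E x y → Star F (f x) (f y)
reroute _≟ᵥ_ f F-sym {u} {w} detour step {x} {y} e
  with (x ≟ᵥ u) ×-dec (y ≟ᵥ w) | (x ≟ᵥ w) ×-dec (y ≟ᵥ u)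
... | yes (refl , refl) | _                 = detour
... | no _              | yes (refl , refl) = reverse F-sym detour
... | no ¬uw            | no ¬wu            = step (e , ¬uw , ¬wu) ◅ ε

module MinimumDegreeTwo {V : Set} (_≟ᵥ_ : DecidableEquality V) (E : Rel V 0ℓ)
  (E-sym : Symmetric E) (E-irrefl : ∀ {x} → ¬ E x x)
  (vertices : List V) (∈-vertices : ∀ x → x ∈ vertices)
  (anotherNeighbour : ∀ {x w} → E x w → ∃[ z ] E x z × z ≢ w) where

  NonBridgeEdge : Set
  NonBridgeEdge = ∃₂ λ u w → E u w × Star (Avoiding E u w) u w

  private
    walk-along : ∀ {u a ys y} → Linked E (a ∷ ys) → y ∈ a ∷ ys → All (u ≢_) (a ∷ ys) →
      Star (Avoiding E u y) a y
    walk-along _          (here refl)  _                        = ε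
    walk-along (a~b ∷ path) (there y∈ys) (u≢a ∷ u∉ys@(u≢b ∷ _)) =
      (a~b , (λ (a≡u , _) → u≢a (sym a≡u)) , (λ (_ , b≡u) → u≢b (sym b≡u)))
      ◅ walk-along path y∈ys u∉ys

    ≢-of-E : ∀ {x z} → E x z → x ≢ z
    ≢-of-E x~z refl = E-irrefl x~z

    -- Grow a simple path x, w, … at its head by a neighbour z ≠ w of x until z already lies
    -- on the path; the path from w to z then closes a cycle through the edge xz. The fuel
    -- runs out only if the path is longer than the vertex list, which uniqueness forbids.
    search : ∀ fuel x w rest → Linked E (x ∷ w ∷ rest) → Unique (x ∷ w ∷ rest) →
      length vertices < fuel + length (x ∷ w ∷ rest) → NonBridgeEdge
    search zero _ _ _ _ uniq N<len =
      ⊥-elim (<⇒≱ N<len (Unique-⊆⇒length≤ uniq λ {z} _ → ∈-vertices z))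
    search (suc fuel) x w rest path@(x~w ∷ path') uniq@(x∉ ∷ _) N<len
      with z , x~z , z≢w ← anotherNeighbour x~w
      with any? (z ≟ᵥ_) rest
    ... | yes z∈rest =
      x , z , x~z , (x~w , (λ (_ , w≡z) → z≢w (sym w≡z)) , (λ (x≡z , _) → ≢-of-E x~z x≡z))
                    ◅ walk-along path' (there z∈rest) x∉
    ... | no z∉rest =
      search fuel z x (w ∷ rest) (E-sym x~z ∷ path)
        ((≢-of-E (E-sym x~z) ∷ z≢w ∷ ¬Any⇒All¬ rest z∉rest) ∷ uniq)
        (subst (length vertices <_) (sym (+-suc fuel _)) N<len)

  nonBridgeEdge : ∀ {x w} → E x w → NonBridgeEdge
  nonBridgeEdge {x} {w} x~w =
    search (length vertices) x w [] (x~w ∷ [-]) ((≢-of-E x~w ∷ []) ∷ [] ∷ [])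
      (m<m+n (length vertices) (s≤s z≤n))

adj-sym : ∀ {v b} {I : Incidence v b} → Symmetric (Adj I)
adj-sym {x = inj₁ _} {inj₂ _} a = a
adj-sym {x = inj₂ _} {inj₁ _} a = a

adj-irrefl : ∀ {v b} {I : Incidence v b} {x} → ¬ Adj I x x
adj-irrefl {x = inj₁ _} ()
adj-irrefl {x = inj₂ _} ()

_≟ᵥ_ : ∀ {v b} → DecidableEquality (Vertex v b)
_≟ᵥ_ = ≡-dec _≟_ _≟_

vertices : ∀ v b → List (Vertex v b)
vertices v b = map inj₁ (allFin v) ++ map inj₂ (allFin b)

∈-vertices : ∀ {v b} (x : Vertex v b) → x ∈ vertices v b
∈-vertices     (inj₁ p) = ∈-++⁺ˡ (∈-map⁺ inj₁ (∈-allFin p))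
∈-vertices {v} (inj₂ l) = ∈-++⁺ʳ (map inj₁ (allFin v)) (∈-map⁺ inj₂ (∈-allFin l))

point-neighbour : ∀ {v b r} {I : Incidence v b} → PointRegular I r → 1 ≤ r →
  ∀ p → ∃[ l ] I p l ≡ true
point-neighbour {I = I} pointDeg 1≤r p = count-witness (I p) (subst (1 ≤_) (sym (pointDeg p)) 1≤r)

module _ {v b r k} {I : Incidence v b} (pointDeg : PointRegular I r) (lineDeg : LineRegular I k) where

  adj-anotherNeighbour : 2 ≤ r → 2 ≤ k → ∀ {x w} → Adj I x w → ∃[ z ] Adj I x z × z ≢ w
  adj-anotherNeighbour 2≤r _ {inj₁ p} {inj₂ l} _ =
    let m , m≢l , e = count-witness-≢ (I p) (subst (2 ≤_) (sym (pointDeg p)) 2≤r) l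
    in inj₂ m , e , m≢l ∘ inj₂-injective
  adj-anotherNeighbour _ 2≤k {inj₂ l} {inj₁ p} _ =
    let q , q≢p , e = count-witness-≢ (λ q → I q l) (subst (2 ≤_) (sym (lineDeg l)) 2≤k) p
    in inj₁ q , e , q≢p ∘ inj₁-injective

  incidence-nonBridgeEdge : 2 ≤ r → 2 ≤ k → Fin v →
    ∃₂ λ p l → I p l ≡ true × Star (Avoiding (Adj I) (inj₁ p) (inj₂ l)) (inj₁ p) (inj₂ l)
  incidence-nonBridgeEdge 2≤r 2≤k p₀
    with l₀ , e₀ ← point-neighbour pointDeg (≤-trans (n≤1+n 1) 2≤r) p₀
    with MinimumDegreeTwo.nonBridgeEdge _≟ᵥ_ (Adj I) adj-sym adj-irrefl (vertices v b) ∈-vertices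
           (adj-anotherNeighbour 2≤r 2≤k) {inj₁ p₀} {inj₂ l₀} e₀
  ... | inj₁ p , inj₂ l , e , cycle = p , l , e , cycle
  ... | inj₂ l , inj₁ p , e , cycle = p , l , e , reverse (avoiding-reverse adj-sym) cycle

edge : ∀ {v b} → Fin v → Fin b → Incidence v b
edge p l q m = does (q ≟ p) ∧ does (m ≟ l)

deleteEdge : ∀ {v b} → Incidence v b → Fin v → Fin b → Incidence v b
deleteEdge I p l q m = not (edge p l q m) ∧ I q m

module _ {v b} {p : Fin v} {l : Fin b} where

  edge-flip : ∀ q m → edge p l q m ≡ edge l p m q
  edge-flip q m = ∧-comm (does (q ≟ p)) (does (m ≟ l))

  deleteEdge-flip : ∀ (I : Incidence v b) q m → deleteEdge I p l q m ≡ deleteEdge (flip I) l p m q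
  deleteEdge-flip I q m = cong (λ β → not β ∧ I q m) (edge-flip q m)

  edge-self : edge p l p l ≡ true
  edge-self = cong₂ _∧_ (dec-true (p ≟ p) refl) (dec-true (l ≟ l) refl)

  edge≡true⇒ : ∀ {q m} → edge p l q m ≡ true → q ≡ p × m ≡ l
  edge≡true⇒ {q} {m} e with q ≟ p | m ≟ l
  ... | yes q≡p | yes m≡l = q≡p , m≡l

  deleteEdge≡true⇒ : ∀ {I : Incidence v b} {q m} → deleteEdge I p l q m ≡ true →
    I q m ≡ true × ¬ (q ≡ p × m ≡ l)
  deleteEdge≡true⇒ {q = q} {m} e with q ≟ p | m ≟ l
  ... | yes _   | no m≢l = e , m≢l ∘ proj₂
  ... | no q≢p  | _      = e , q≢p ∘ proj₁

  deleteEdge≡true⇐ : ∀ {I : Incidence v b} {q m} → I q m ≡ true → ¬ (q ≡ p × m ≡ l) →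
    deleteEdge I p l q m ≡ true
  deleteEdge≡true⇐ {q = q} {m} e ¬edge with q ≟ p | m ≟ l
  ... | yes q≡p | yes m≡l = ⊥-elim (¬edge (q≡p , m≡l))
  ... | yes _   | no _    = e
  ... | no _    | _       = e

  avoiding⇒adj-deleteEdge : ∀ {I : Incidence v b} {x y} →
    Avoiding (Adj I) (inj₁ p) (inj₂ l) x y → Adj (deleteEdge I p l) x y
  avoiding⇒adj-deleteEdge {I} {inj₁ q} {inj₂ m} (e , ¬pl , _) =
    deleteEdge≡true⇐ {I} e λ (q≡p , m≡l) → ¬pl (cong inj₁ q≡p , cong inj₂ m≡l)
  avoiding⇒adj-deleteEdge {I} {inj₂ m} {inj₁ q} (e , _ , ¬lp) =
    deleteEdge≡true⇐ {I} e λ (q≡p , m≡l) → ¬lp (cong inj₂ m≡l , cong inj₁ q≡p)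

  count-deleteEdge-+-edge : ∀ {I : Incidence v b} {b''} (l'' : Fin b'') → I p l ≡ true → ∀ q →
    count (deleteEdge I p l q) + count (edge p l'' q) ≡ count (I q)
  count-deleteEdge-+-edge {I} {b''} l'' e q with q ≟ p
  ... | yes refl = begin
    count (λ m → not (does (m ≟ l)) ∧ I q m) + count (λ m → does (m ≟ l''))
      ≡⟨ trans (cong (_ +_) (count-≟ l'')) (+-comm _ 1) ⟩
    1 + count (λ m → not (does (m ≟ l)) ∧ I q m)
      ≡⟨ cong (λ β → (if β then 1 else 0) + count (λ m → not (does (m ≟ l)) ∧ I q m)) e ⟨
    (if I q l then 1 else 0) + count (λ m → not (does (m ≟ l)) ∧ I q m)
      ≡⟨ count-isolate (I q) l ⟨
    count (I q) ∎
  ... | no _ = trans (cong (count (I q) +_) (count-false b'')) (+-identityʳ _)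


splitAt-injective : ∀ n {n'} {q q' : Fin (n + n')} → splitAt n q ≡ splitAt n q' → q ≡ q'
splitAt-injective n {n'} {q} {q'} eq =
  trans (sym (join-splitAt n n' q)) (trans (cong (join n n') eq) (join-splitAt n n' q'))

module Embedding (v b v' b' : ℕ) where

  embedˡ : Vertex v b → Vertex (v + v') (b + b')
  embedˡ = Sum.map (_↑ˡ v') (_↑ˡ b')

  embedʳ : Vertex v' b' → Vertex (v + v') (b + b')
  embedʳ = Sum.map (v ↑ʳ_) (b ↑ʳ_)

  embed-cover : ∀ x → (∃[ y ] embedˡ y ≡ x) ⊎ (∃[ y ] embedʳ y ≡ x)
  embed-cover (inj₁ q) with splitAt v q in eq
  ... | inj₁ q₁ = inj₁ (inj₁ q₁ , cong inj₁ (splitAt⁻¹-↑ˡ eq))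
  ... | inj₂ q₂ = inj₂ (inj₁ q₂ , cong inj₁ (splitAt⁻¹-↑ʳ eq))
  embed-cover (inj₂ m) with splitAt b m in eq
  ... | inj₁ m₁ = inj₁ (inj₂ m₁ , cong inj₂ (splitAt⁻¹-↑ˡ eq))
  ... | inj₂ m₂ = inj₂ (inj₂ m₂ , cong inj₂ (splitAt⁻¹-↑ʳ eq))

module _ {v b v' b'} (I : Incidence v b) (J : Incidence v' b')
         (p : Fin v) (l : Fin b) (p' : Fin v') (l' : Fin b') where

  glue⊎ : Fin v ⊎ Fin v' → Fin b ⊎ Fin b' → Bool
  glue⊎ (inj₁ q) (inj₁ m) = deleteEdge I p l q m
  glue⊎ (inj₁ q) (inj₂ m) = edge p l' q m
  glue⊎ (inj₂ q) (inj₁ m) = edge p' l q m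
  glue⊎ (inj₂ q) (inj₂ m) = deleteEdge J p' l' q m

  glue : Incidence (v + v') (b + b')
  glue q m = glue⊎ (splitAt v q) (splitAt b m)

module _ {v b v' b'} {I : Incidence v b} {J : Incidence v' b'}
         {p : Fin v} {l : Fin b} {p' : Fin v'} {l' : Fin b'} where

  glue⊎-flip : ∀ s t → glue⊎ I J p l p' l' s t ≡ glue⊎ (flip I) (flip J) l p l' p' t s
  glue⊎-flip (inj₁ q) (inj₁ m) = deleteEdge-flip I q m
  glue⊎-flip (inj₁ q) (inj₂ m) = edge-flip q m
  glue⊎-flip (inj₂ q) (inj₁ m) = edge-flip q m
  glue⊎-flip (inj₂ q) (inj₂ m) = deleteEdge-flip J q m

  glue-pointRegular : ∀ {r} → PointRegular I r → PointRegular J r →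
    I p l ≡ true → J p' l' ≡ true →
    PointRegular (glue I J p l p' l') r
  glue-pointRegular {r} pointDegI pointDegJ e e' q =
    trans (count-splitAt b (glue⊎ I J p l p' l' (splitAt v q))) (row (splitAt v q))
    where
    row : ∀ s → count (glue⊎ I J p l p' l' s ∘ inj₁) + count (glue⊎ I J p l p' l' s ∘ inj₂)
                ≡ r
    row (inj₁ q) = trans (count-deleteEdge-+-edge {p = p} {l} l' e q) (pointDegI q)
    row (inj₂ q) = trans (+-comm (count (edge p' l q)) _)
      (trans (count-deleteEdge-+-edge {p = p'} {l'} l e' q) (pointDegJ q))

module _ {v b v' b'} {I : Incidence v b} {J : Incidence v' b'}
         {p : Fin v} {l : Fin b} {p' : Fin v'} {l' : Fin b'} where

  open Embedding v b v' b'

  private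
    H = glue I J p l p' l'

  glue-lineRegular : ∀ {k} → LineRegular I k → LineRegular J k →
    I p l ≡ true → J p' l' ≡ true →
    LineRegular H k
  glue-lineRegular lineDegI lineDegJ e e' m =
    trans (count-cong λ q → glue⊎-flip (splitAt v q) (splitAt b m))
          (glue-pointRegular {I = flip I} {flip J} lineDegI lineDegJ e e' m)

  data GlueEdge : Fin v ⊎ Fin v' → Fin b ⊎ Fin b' → Set where
    inner₁ : ∀ {a c} → I a c ≡ true × ¬ (a ≡ p × c ≡ l) → GlueEdge (inj₁ a) (inj₁ c)
    inner₂ : ∀ {a c} → J a c ≡ true × ¬ (a ≡ p' × c ≡ l') → GlueEdge (inj₂ a) (inj₂ c)
    cross₁ : GlueEdge (inj₁ p) (inj₂ l')
    cross₂ : GlueEdge (inj₂ p') (inj₁ l)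

  glueEdge : ∀ s t → glue⊎ I J p l p' l' s t ≡ true → GlueEdge s t
  glueEdge (inj₁ a) (inj₁ c) h = inner₁ (deleteEdge≡true⇒ {I = I} h)
  glueEdge (inj₂ a) (inj₂ c) h = inner₂ (deleteEdge≡true⇒ {I = J} h)
  glueEdge (inj₁ a) (inj₂ c) h with refl , refl ← edge≡true⇒ {p = p} {l'} {a} {c} h = cross₁
  glueEdge (inj₂ a) (inj₁ c) h with refl , refl ← edge≡true⇒ {p = p'} {l} {a} {c} h = cross₂

  noFourCycle⊎ : NoFourCycle I → NoFourCycle J → ∀ {s s' t t'} → s ≢ s' → t ≢ t' →
    GlueEdge s t → GlueEdge s t' → GlueEdge s' t → GlueEdge s' t' → ⊥
  noFourCycle⊎ noFourI _ {inj₁ a} {inj₁ a'} {inj₁ c} {inj₁ c'} ≢s ≢t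
    (inner₁ (e₁ , _)) (inner₁ (e₂ , _)) (inner₁ (e₃ , _)) (inner₁ (e₄ , _)) =
    noFourI a a' c c' (≢s ∘ cong inj₁) (≢t ∘ cong inj₁) (e₁ , e₂ , e₃ , e₄)
  noFourCycle⊎ _ noFourJ {inj₂ a} {inj₂ a'} {inj₂ c} {inj₂ c'} ≢s ≢t
    (inner₂ (e₁ , _)) (inner₂ (e₂ , _)) (inner₂ (e₃ , _)) (inner₂ (e₄ , _)) =
    noFourJ a a' c c' (≢s ∘ cong inj₂) (≢t ∘ cong inj₂) (e₁ , e₂ , e₃ , e₄)
  noFourCycle⊎ _ _ ≢s _ cross₁ _ cross₁ _ = ≢s refl
  noFourCycle⊎ _ _ ≢s _ cross₂ _ cross₂ _ = ≢s refl
  noFourCycle⊎ _ _ ≢s _ _ cross₁ _ cross₁ = ≢s refl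
  noFourCycle⊎ _ _ ≢s _ _ cross₂ _ cross₂ = ≢s refl
  noFourCycle⊎ _ _ _ ≢t cross₁ cross₁ _ _ = ≢t refl
  noFourCycle⊎ _ _ _ ≢t cross₂ cross₂ _ _ = ≢t refl
  noFourCycle⊎ _ _ _ ≢t _ _ cross₁ cross₁ = ≢t refl
  noFourCycle⊎ _ _ _ ≢t _ _ cross₂ cross₂ = ≢t refl
  noFourCycle⊎ _ _ _ _ (inner₁ (_ , ¬pl)) cross₁ cross₂ _ = ¬pl (refl , refl)
  noFourCycle⊎ _ _ _ _ cross₁ (inner₁ (_ , ¬pl)) _ cross₂ = ¬pl (refl , refl)
  noFourCycle⊎ _ _ _ _ cross₂ _ (inner₁ (_ , ¬pl)) cross₁ = ¬pl (refl , refl)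
  noFourCycle⊎ _ _ _ _ _ cross₂ cross₁ (inner₁ (_ , ¬pl)) = ¬pl (refl , refl)

  glue-noFourCycle : NoFourCycle I → NoFourCycle J → NoFourCycle H
  glue-noFourCycle noFourI noFourJ q q' m m' q≢q' m≢m' (h₁ , h₂ , h₃ , h₄) =
    noFourCycle⊎ noFourI noFourJ (q≢q' ∘ splitAt-injective v) (m≢m' ∘ splitAt-injective b)
      (glueEdge _ _ h₁) (glueEdge _ _ h₂) (glueEdge _ _ h₃) (glueEdge _ _ h₄)

  adj-embedˡ : ∀ {x y} → Adj (deleteEdge I p l) x y → Adj H (embedˡ x) (embedˡ y)
  adj-embedˡ {inj₁ q} {inj₂ m} a rewrite splitAt-↑ˡ v q v' | splitAt-↑ˡ b m b' = a
  adj-embedˡ {inj₂ m} {inj₁ q} a rewrite splitAt-↑ˡ v q v' | splitAt-↑ˡ b m b' = a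

  adj-embedʳ : ∀ {x y} → Adj (deleteEdge J p' l') x y → Adj H (embedʳ x) (embedʳ y)
  adj-embedʳ {inj₁ q} {inj₂ m} a rewrite splitAt-↑ʳ v v' q | splitAt-↑ʳ b b' m = a
  adj-embedʳ {inj₂ m} {inj₁ q} a rewrite splitAt-↑ʳ v v' q | splitAt-↑ʳ b b' m = a

  adj-cross₁ : Adj H (embedˡ (inj₁ p)) (embedʳ (inj₂ l'))
  adj-cross₁ rewrite splitAt-↑ˡ v p v' | splitAt-↑ʳ b b' l' = edge-self {p = p} {l'}

  adj-cross₂ : Adj H (embedʳ (inj₁ p')) (embedˡ (inj₂ l))
  adj-cross₂ rewrite splitAt-↑ʳ v v' p' | splitAt-↑ˡ b l b' = edge-self {p = p'} {l}

  glue-connected : Connected I → Connected J →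
    Star (Avoiding (Adj I) (inj₁ p) (inj₂ l)) (inj₁ p) (inj₂ l) → Connected H
  glue-connected connI connJ cycle x y = toHub x ◅◅ reverse adj-sym (toHub y)
    where
    stepˡ : ∀ {x y} → Avoiding (Adj I) (inj₁ p) (inj₂ l) x y → Adj H (embedˡ x) (embedˡ y)
    stepˡ = adj-embedˡ ∘ avoiding⇒adj-deleteEdge
    stepʳ : ∀ {x y} → Avoiding (Adj J) (inj₁ p') (inj₂ l') x y → Adj H (embedʳ x) (embedʳ y)
    stepʳ = adj-embedʳ ∘ avoiding⇒adj-deleteEdge
    pathˡ : Star (Adj H) (embedˡ (inj₁ p)) (embedˡ (inj₂ l))
    pathˡ = gmap embedˡ stepˡ cycle
    pathʳ : Star (Adj H) (embedʳ (inj₁ p')) (embedʳ (inj₂ l'))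
    pathʳ = adj-cross₂ ◅ reverse adj-sym pathˡ ◅◅ adj-cross₁ ◅ ε
    liftˡ : ∀ {x y} → Star (Adj I) x y → Star (Adj H) (embedˡ x) (embedˡ y)
    liftˡ = kleisliStar embedˡ (reroute _≟ᵥ_ embedˡ adj-sym pathˡ stepˡ)
    liftʳ : ∀ {x y} → Star (Adj J) x y → Star (Adj H) (embedʳ x) (embedʳ y)
    liftʳ = kleisliStar embedʳ (reroute _≟ᵥ_ embedʳ adj-sym pathʳ stepʳ)
    toHub : ∀ x → Star (Adj H) x (embedˡ (inj₁ p))
    toHub x with embed-cover x
    ... | inj₁ (y , refl) = liftˡ (connI y (inj₁ p))
    ... | inj₂ (y , refl) =
      liftʳ (connJ y (inj₁ p')) ◅◅ adj-cross₂ ◅ liftˡ (connI (inj₂ l) (inj₁ p))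

open Configuration

glueConfigurations : ∀ {v b v' b' r k} → 2 ≤ r → 2 ≤ k →
  Configuration (suc v) b r k → Configuration (suc v') b' r k →
  Configuration (suc v + suc v') (b + b') r k
glueConfigurations 2≤r 2≤k G G'
  with p , l , e , cycle ← incidence-nonBridgeEdge (pointDegree G) (lineDegree G) 2≤r 2≤k zero
  with l' , e' ← point-neighbour (pointDegree G') (≤-trans (n≤1+n 1) 2≤r) zero
  = record
  { incidence   = glue (incidence G) (incidence G') p l zero l'
  ; connected   = glue-connected (connected G) (connected G') cycle
  ; pointDegree = glue-pointRegular {I = incidence G} {incidence G'} (pointDegree G) (pointDegree G') e e'
  ; lineDegree  = glue-lineRegular {I = incidence G} {incidence G'} (lineDegree G) (lineDegree G') e e'
  ; noFourCycle = glue-noFourCycle {p = p} {l} {zero} {l'} (noFourCycle G) (noFourCycle G')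
  }

noPoints⇒noLines : ∀ {b r k} → 1 ≤ k → Configuration 0 b r k → b ≡ 0
noPoints⇒noLines {zero}  _   _ = refl
noPoints⇒noLines {suc b} 1≤k G = contradiction (subst (1 ≤_) (sym (lineDegree G zero)) 1≤k) λ ()

lemma7 : (r k : ℕ) → 3 ≤ r → 3 ≤ k →
    (v b v' b' : ℕ) → Configurable v b r k → Configurable v' b' r k →
    Configurable (v + v') (b + b') r k
lemma7 r k 3≤r 3≤k zero b v' b' G G'
  rewrite noPoints⇒noLines (≤-trans (s≤s z≤n) 3≤k) G = G'
lemma7 r k 3≤r 3≤k (suc v) b zero b' G G'
  rewrite noPoints⇒noLines (≤-trans (s≤s z≤n) 3≤k) G' | +-identityʳ v | +-identityʳ b = G
lemma7 r k 3≤r 3≤k (suc v) b (suc v') b' G G' =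
  glueConfigurations (≤-trans (n≤1+n 2) 3≤r) (≤-trans (n≤1+n 2) 3≤k) G G'
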